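{- Let $n,k,\ell$ be integers with $1\le k\le n$ and $\ell\ge 0$. There exists a (randomized) algorithm that solves the $\ell$-bounded error partition learning problem on $V=[n]$ for hidden partitions into $k$ clusters and makes at most $$ (\ell+1)\left( \frac{n(k+1)}{2} - k \right) + \ell $$ queries in expectation (over the algorithm's internal randomness), both when $k$ is known to the algorithm and when it is not.
   Context: Given a partition $\mathcal{C}$ of a finite set $V$, the same-cluster oracle $\alpha_{\mathcal{C}}$ takes a pair $\{u,v\}$ of distinct elements of $V$ and returns $1$ if $u,v$ lie in the same cluster of $\mathcal{C}$ and $-1$ otherwise. An $\ell$-faulty same-cluster oracle may return an incorrect answer on at most $\ell$ of the queries made over the whole run; errors may be chosen adversarially and are not persistent (repeating a query may give different answers). The $\ell$-bounded error partition learning problem is: given $V$ and access to an $\ell$-faulty same-cluster oracle for an unknown partition $\mathcal{C}$ of $V$ into $k$ nonempty clusters, always exactly recover $\mathcal{C}$. The expectation bound holds for every hidden partition and every admissible oracle behavior. -}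

module Defs where

open import Data.Nat as ℕ using (ℕ; zero; suc)
open import Data.Fin using (Fin; zero; suc; _≟_)
open import Data.Bool using (Bool; true; false)
open import Data.List using (List; []; _∷_)
open import Data.Product using (Σ; ∃; _×_; _,_)
open import Data.Unit using (⊤)
open import Data.Integer using (+_)
open import Data.Rational as ℚ using (ℚ; 0ℚ; 1ℚ; _/_; _+_; _*_; _-_)
open import Relation.Nullary using (¬_; does)
open import Relation.Binary.PropositionalEquality using (_≡_; _≢_)

-- A randomized query algorithm on V = Fin n, as a (well-founded) decision tree:
--   output f     : stop and output the partition {u,v same cluster iff f u ≡ f v}
--   query u v p k: ask the oracle about the pair {u,v} (u ≢ v), continue with k answer
--                  (true = +1 "same cluster", false = -1)
--   coin m f     : draw i uniformly at random from Fin (suc m), continue with f i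
data Alg (n : ℕ) : Set where
  output : (Fin n → ℕ) → Alg n
  query  : (u v : Fin n) → u ≢ v → (Bool → Alg n) → Alg n
  coin   : (m : ℕ) → (Fin (suc m) → Alg n) → Alg n

-- Transcript of queries so far (most recent first) together with the answers received.
History : ℕ → Set
History n = List (Fin n × Fin n × Bool)

Oracle : ℕ → Set
Oracle n = History n → Fin n → Fin n → Bool

truth : {n k : ℕ} → (Fin n → Fin k) → Fin n → Fin n → Bool
truth c u v = does (c u ≟ c v)

-- c : Fin n → Fin k describes a partition into exactly k nonempty clusters iff surjective.
IsSurj : {n k : ℕ} → (Fin n → Fin k) → Set
IsSurj {n} {k} c = (j : Fin k) → ∃ λ (i : Fin n) → c i ≡ j

-- Admissible t c adv h b : on every run of t (every outcome of the coins), starting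
-- from transcript h, the oracle adv gives at most b incorrect answers w.r.t. truth c.
data Admissible {n k : ℕ} (c : Fin n → Fin k) (adv : Oracle n)
     : Alg n → History n → ℕ → Set where
  adm-out  : ∀ {f h b} → Admissible c adv (output f) h b
  adm-ok   : ∀ {u v p t h b} → adv h u v ≡ truth c u v →
             Admissible c adv (t (adv h u v)) ((u , v , adv h u v) ∷ h) b →
             Admissible c adv (query u v p t) h b
  adm-err  : ∀ {u v p t h b} → adv h u v ≢ truth c u v →
             Admissible c adv (t (adv h u v)) ((u , v , adv h u v) ∷ h) b →
             Admissible c adv (query u v p t) h (suc b)
  adm-coin : ∀ {m t h b} → (∀ i → Admissible c adv (t i) h b) →
             Admissible c adv (coin m t) h b

SamePartition : {n k : ℕ} → (Fin n → ℕ) → (Fin n → Fin k) → Set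
SamePartition {n} f c = (u v : Fin n) → (f u ≡ f v → c u ≡ c v) × (c u ≡ c v → f u ≡ f v)

AlwaysCorrect : {n k : ℕ} → (Fin n → Fin k) → Oracle n → Alg n → History n → Set
AlwaysCorrect c adv (output f) h = SamePartition f c
AlwaysCorrect c adv (query u v p t) h =
  AlwaysCorrect c adv (t (adv h u v)) ((u , v , adv h u v) ∷ h)
AlwaysCorrect c adv (coin m t) h = (i : Fin (suc m)) → AlwaysCorrect c adv (t i) h

sumFin : (m : ℕ) → (Fin m → ℚ) → ℚ
sumFin zero    g = 0ℚ
sumFin (suc m) g = g zero + sumFin m (λ i → g (suc i))

expQueries : {n : ℕ} → Oracle n → Alg n → History n → ℚ
expQueries adv (output f) h = 0ℚ
expQueries adv (query u v p t) h =
  1ℚ + expQueries adv (t (adv h u v)) ((u , v , adv h u v) ∷ h)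
expQueries adv (coin m t) h =
  sumFin (suc m) (λ i → expQueries adv (t i) h) * ((+ 1) / suc m)

bound : ℕ → ℕ → ℕ → ℚ
bound n k ℓ =
  ((+ suc ℓ) / 1) * (((+ (n ℕ.* suc k)) / 2) - ((+ k) / 1)) + ((+ ℓ) / 1)

Solves : (n k ℓ : ℕ) → Alg n → Set
Solves n k ℓ A =
  (c : Fin n → Fin k) → IsSurj c → (adv : Oracle n) → Admissible c adv A [] ℓ →
  AlwaysCorrect c adv A [] × expQueries adv A [] ℚ.≤ bound n k ℓ

module Submission where

-- The learner inserts the elements one at a time, keeping one representative per cluster
-- found so far and comparing the new element with the representatives, scanned in one of two
-- opposite orders chosen by a fair coin. A comparison is a vote: the pair is queried until one
-- answer has been received ℓ + 1 times. As at most ℓ answers are wrong, that answer is the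
-- truth, and the vote costs ℓ + 1 queries plus the errors spent in it. An element whose
-- cluster already has one of the D current representatives is found after (D + 1)/2
-- comparisons on average over the two orders; an element opening a new cluster costs D.
-- Since D ≤ k and the new clusters are opened at D = 0, 1, …, k − 1, there are at most
-- n(k + 1)/2 − k comparisons in expectation, hence (ℓ + 1)(n(k + 1)/2 − k) + ℓ queries.
-- The learner never looks at k, so one learner serves every k.

open import Defs
open import Data.Nat as ℕ using (ℕ; zero; suc; _≤_; _<_; z≤n; s≤s)
import Data.Nat.Properties as ℕ
open import Algebra.Properties.CommutativeSemigroup ℕ.+-commutativeSemigroup using (x∙yz≈y∙xz)
open import Data.Fin as Fin using (Fin; toℕ; _≟_)
import Data.Fin.Properties as Fin
open import Data.Bool using (Bool; true; false; not; if_then_else_)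
open import Data.List using (List; []; _∷_; _++_; [_]; length; lookup; reverse; allFin)
import Data.List.Properties as List
open import Data.List.Relation.Unary.Any as Any using (Any; here; there; any?; index)
import Data.List.Relation.Unary.Any.Properties as Any
import Data.List.Relation.Unary.All as All
import Data.List.Relation.Unary.All.Properties as All
open import Data.List.Relation.Unary.AllPairs using (AllPairs; []; _∷_)
open import Data.List.Membership.Propositional using (_∈_; find; lose)
open import Data.List.Membership.Propositional.Properties using (∈-lookup; ∈-allFin)
open import Data.List.Relation.Binary.Subset.Propositional using (_⊆_)
open import Data.List.Relation.Binary.Subset.Propositional.Properties using (Any-resp-⊆)
open import Data.Vec.Functional using (updateAt)
open import Data.Vec.Functional.Properties using (updateAt-updates; updateAt-minimal)
open import Data.Product as Product using (Σ; _×_; _,_; proj₁)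
open import Data.Sum as Sum using (_⊎_; inj₁; inj₂)
open import Data.Empty using (⊥-elim)
import Data.Rational as ℚ
import Data.Rational.Properties as ℚ
open import Function using (id; const; _∘_; _∘′_)
open import Relation.Nullary using (Dec; yes; no; ¬_)
open import Relation.Nullary.Decidable using (dec-true; dec-false)
open import Relation.Binary.PropositionalEquality hiding ([_])

pattern heads = Fin.zero
pattern tails = Fin.suc Fin.zero

module Half where
  open import Data.Integer as ℤ using (+_)
  import Data.Integer.Properties as ℤ
  import Data.Rational.Unnormalised as ℚᵘ
  import Data.Rational.Unnormalised.Properties as ℚᵘ
  open import Data.Rational using (ℚ; 0ℚ; ½; _/_; _+_; _*_; _-_; toℚᵘ)
  open import Data.Rational.Solver using (module +-*-Solver)

  ι : ℕ → ℚ
  ι a = + a / 1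

  toℚᵘ-ι : ∀ a → toℚᵘ (ι a) ℚᵘ.≃ ℚᵘ.mkℚᵘ (+ a) 0
  toℚᵘ-ι a = ℚ.toℚᵘ-fromℚᵘ (ℚᵘ.mkℚᵘ (+ a) 0)

  ι-homo-+ : ∀ a b → ι (a ℕ.+ b) ≡ ι a + ι b
  ι-homo-+ a b = ℚ.toℚᵘ-injective (begin-equality
    toℚᵘ (ι (a ℕ.+ b))                   ≃⟨ toℚᵘ-ι (a ℕ.+ b) ⟩
    ℚᵘ.mkℚᵘ (+ (a ℕ.+ b)) 0              ≃⟨ ℚᵘ.*≡* (cong (ℤ._* + 1) (trans (ℤ.pos-+ a b)
                                               (sym (cong₂ ℤ._+_ (ℤ.*-identityʳ (+ a)) (ℤ.*-identityʳ (+ b)))))) ⟩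
    ℚᵘ.mkℚᵘ (+ a) 0 ℚᵘ.+ ℚᵘ.mkℚᵘ (+ b) 0 ≃⟨ ℚᵘ.+-cong (toℚᵘ-ι a) (toℚᵘ-ι b) ⟨
    toℚᵘ (ι a) ℚᵘ.+ toℚᵘ (ι b)           ≃⟨ ℚ.toℚᵘ-homo-+ (ι a) (ι b) ⟨
    toℚᵘ (ι a + ι b)                     ∎)
    where open ℚᵘ.≤-Reasoning

  ι-homo-* : ∀ a b → ι (a ℕ.* b) ≡ ι a * ι b
  ι-homo-* a b = ℚ.toℚᵘ-injective (begin-equality
    toℚᵘ (ι (a ℕ.* b))                   ≃⟨ toℚᵘ-ι (a ℕ.* b) ⟩
    ℚᵘ.mkℚᵘ (+ (a ℕ.* b)) 0              ≃⟨ ℚᵘ.*≡* (cong (ℤ._* + 1) (ℤ.pos-* a b)) ⟩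
    ℚᵘ.mkℚᵘ (+ a) 0 ℚᵘ.* ℚᵘ.mkℚᵘ (+ b) 0 ≃⟨ ℚᵘ.*-cong (toℚᵘ-ι a) (toℚᵘ-ι b) ⟨
    toℚᵘ (ι a) ℚᵘ.* toℚᵘ (ι b)           ≃⟨ ℚ.toℚᵘ-homo-* (ι a) (ι b) ⟨
    toℚᵘ (ι a * ι b)                     ∎)
    where open ℚᵘ.≤-Reasoning

  ι-mono-≤ : ∀ {a b} → a ℕ.≤ b → ι a ℚ.≤ ι b
  ι-mono-≤ {a} {b} a≤b = ℚ.toℚᵘ-cancel-≤ (begin
    toℚᵘ (ι a)      ≃⟨ toℚᵘ-ι a ⟩
    ℚᵘ.mkℚᵘ (+ a) 0 ≤⟨ ℚᵘ.*≤* (ℤ.*-monoʳ-≤-nonNeg (+ 1) (ℤ.+≤+ a≤b)) ⟩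
    ℚᵘ.mkℚᵘ (+ b) 0 ≃⟨ toℚᵘ-ι b ⟨
    toℚᵘ (ι b)      ∎)
    where open ℚᵘ.≤-Reasoning

  half : ℕ → ℚ
  half a = ι a * ½

  half-homo-+ : ∀ a b → half (a ℕ.+ b) ≡ half a + half b
  half-homo-+ a b = trans (cong (_* ½) (ι-homo-+ a b)) (ℚ.*-distribʳ-+ ½ (ι a) (ι b))

  half-mono-≤ : ∀ {a b} → a ℕ.≤ b → half a ℚ.≤ half b
  half-mono-≤ a≤b = ℚ.*-monoʳ-≤-nonNeg ½ (ι-mono-≤ a≤b)

  half-nonNeg : ∀ a → 0ℚ ℚ.≤ half a
  half-nonNeg a = half-mono-≤ (ℕ.z≤n {a})

  half-*2 : ∀ a → half (a ℕ.* 2) ≡ ι a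
  half-*2 a = trans (cong (_* ½) (ι-homo-* a 2)) (trans (ℚ.*-assoc (ι a) (ι 2) ½) (ℚ.*-identityʳ (ι a)))

  /2≡half : ∀ a → + a / 2 ≡ half a
  /2≡half a = ℚ.toℚᵘ-injective (begin-equality
    toℚᵘ (+ a / 2)                         ≃⟨ ℚ.toℚᵘ-fromℚᵘ (ℚᵘ.mkℚᵘ (+ a) 1) ⟩
    ℚᵘ.mkℚᵘ (+ a) 1                        ≃⟨ ℚᵘ.*≡* (cong (ℤ._* + 2) (sym (ℤ.*-identityʳ (+ a)))) ⟩
    ℚᵘ.mkℚᵘ (+ a) 0 ℚᵘ.* toℚᵘ ½            ≃⟨ ℚᵘ.*-congʳ (toℚᵘ-ι a) ⟨
    toℚᵘ (ι a) ℚᵘ.* toℚᵘ ½                 ≃⟨ ℚ.toℚᵘ-homo-* (ι a) ½ ⟨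
    toℚᵘ (half a)                          ∎)
    where open ℚᵘ.≤-Reasoning

  bound-as-half : ∀ n k ℓ →
                  bound n k ℓ ≡ half (suc ℓ ℕ.* (n ℕ.* suc k) ℕ.+ ℓ ℕ.* 2) - ι (suc ℓ ℕ.* k)
  bound-as-half n k ℓ = begin
    ι L * (+ m / 2 - ι k) + ι ℓ                   ≡⟨ cong (λ h → ι L * (h - ι k) + ι ℓ) (/2≡half m) ⟩
    ι L * (ι m * ½ - ι k) + ι ℓ                   ≡⟨ solve 4 (λ l m k x →
                                                       l :* (m :* con ½ :- k) :+ x := (l :* m :* con ½ :+ x) :- l :* k)
                                                     refl (ι L) (ι m) (ι k) (ι ℓ) ⟩
    (ι L * ι m * ½ + ι ℓ) - ι L * ι k             ≡⟨ cong₂ (λ h i → (h * ½ + i) - ι L * ι k)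
                                                       (ι-homo-* L m) (half-*2 ℓ) ⟨
    (half (L ℕ.* m) + half (ℓ ℕ.* 2)) - ι L * ι k ≡⟨ cong₂ _-_ (half-homo-+ (L ℕ.* m) (ℓ ℕ.* 2)) (ι-homo-* L k) ⟨
    half (L ℕ.* m ℕ.+ ℓ ℕ.* 2) - ι (L ℕ.* k)      ∎
    where
    open ≡-Reasoning
    open +-*-Solver
    L = suc ℓ
    m = n ℕ.* suc k

  half-≤-minus : ∀ {x y z} → x ℕ.+ z ℕ.* 2 ℕ.≤ y → half x ℚ.≤ half y - ι z
  half-≤-minus {x} {y} {z} le = begin
    half x                      ≡⟨ solve 2 (λ h i → h := (h :+ i) :- i) refl (half x) (ι z) ⟩
    (half x + ι z) - ι z        ≡⟨ cong (λ i → (half x + i) - ι z) (half-*2 z) ⟨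
    (half x + half (z ℕ.* 2)) - ι z ≡⟨ cong (_- ι z) (half-homo-+ x (z ℕ.* 2)) ⟨
    half (x ℕ.+ z ℕ.* 2) - ι z  ≤⟨ ℚ.+-monoˡ-≤ (ℚ.- ι z) (half-mono-≤ le) ⟩
    half y - ι z                ∎
    where
    open ℚ.≤-Reasoning
    open +-*-Solver

  twice-half : ∀ p → (p + p) * ½ ≡ p
  twice-half p = solve 1 (λ x → (x :+ x) :* con ½ := x) refl p
    where open +-*-Solver

  half-average : ∀ (p : Fin 2 → ℚ) a b c → p heads ℚ.≤ half a → p tails ℚ.≤ half b →
                 a ℕ.+ b ℕ.≤ c ℕ.+ c → sumFin 2 p * ½ ℚ.≤ half c
  half-average p a b c pa pb a+b≤2c = begin
    (p heads + (p tails + 0ℚ)) * ½ ≡⟨ cong (λ q → (p heads + q) * ½) (ℚ.+-identityʳ (p tails)) ⟩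
    (p heads + p tails) * ½        ≤⟨ ℚ.*-monoʳ-≤-nonNeg ½ (begin
        p heads + p tails ≤⟨ ℚ.+-mono-≤ pa pb ⟩
        half a + half b   ≡⟨ half-homo-+ a b ⟨
        half (a ℕ.+ b)    ≤⟨ half-mono-≤ a+b≤2c ⟩
        half (c ℕ.+ c)    ≡⟨ half-homo-+ c c ⟩
        half c + half c   ∎) ⟩
    (half c + half c) * ½          ≡⟨ twice-half (half c) ⟩
    half c                         ∎
    where open ℚ.≤-Reasoning

open Half

module Learner (n ℓ : ℕ) where

  module _ {u v : Fin n} (u≢v : u ≢ v) (K : Bool → Alg n) where
    mutual
      vote : (same diff : ℕ) → Alg n
      vote zero    diff    = K true
      vote (suc s) zero    = K false
      vote (suc s) (suc d) = query u v u≢v (vote-after s d)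

      vote-after : ℕ → ℕ → Bool → Alg n
      vote-after s d true  = vote s (suc d)
      vote-after s d false = vote (suc s) d

  -- The learner never compares an element with itself; testing x ≟ r supplies the
  -- distinctness that a query requires.
  ifSameCluster : (x r : Fin n) → Alg n → Alg n → Alg n
  ifSameCluster x r A B with x ≟ r
  ... | yes _   = A
  ... | no x≢r = vote x≢r (λ b → if b then A else B) (suc ℓ) (suc ℓ)

  assign : (Fin n → ℕ) → Fin n → Fin n → Fin n → ℕ
  assign g x r = updateAt g x (const (toℕ r))

  order : Fin 2 → List (Fin n) → List (Fin n)
  order heads = id
  order tails = reverse

  -- State: the elements xs still to insert, one representative rs per cluster found so far,
  -- and a labelling g giving each inserted element the index of its cluster's representative.
  mutual
    process : List (Fin n) → List (Fin n) → (Fin n → ℕ) → Alg n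
    process []       rs g = output g
    process (x ∷ xs) rs g = coin 1 (λ i → scan x xs rs g (order i rs))

    scan : Fin n → List (Fin n) → List (Fin n) → (Fin n → ℕ) → List (Fin n) → Alg n
    scan x xs rs g []      = process xs (x ∷ rs) (assign g x x)
    scan x xs rs g (r ∷ L) = ifSameCluster x r (process xs rs (assign g x r)) (scan x xs rs g L)

  learner : Alg n
  learner = process (allFin n) [] (const 0)

module Analysis (n ℓ k : ℕ) (c : Fin n → Fin k) where
  open import Data.Nat using (_+_; _*_)
  open import Data.Nat.Solver using (module +-*-Solver)
  import Data.Nat.Tactic.RingSolver as RS
  open Learner n ℓ

  Represented : Fin n → List (Fin n) → Set
  Represented y rs = Any (λ r → c y ≡ c r) rs

  represented? : ∀ y rs → Dec (Represented y rs)
  represented? y rs = any? (λ r → c y ≟ c r) rs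

  DistinctClusters : List (Fin n) → Set
  DistinctClusters = AllPairs (λ r s → c r ≢ c s)

  distinct-unique : ∀ {rs r s} → DistinctClusters rs → r ∈ rs → s ∈ rs → c r ≡ c s → r ≡ s
  distinct-unique _           (here refl) (here refl) _ = refl
  distinct-unique (r≢ ∷ _)    (here refl) (there s∈) e  = ⊥-elim (All.lookup r≢ s∈ e)
  distinct-unique (s≢ ∷ _)    (there r∈)  (here refl) e = ⊥-elim (All.lookup s≢ r∈ (sym e))
  distinct-unique (_ ∷ rs!)   (there r∈)  (there s∈) e  = distinct-unique rs! r∈ s∈ e

  distinct-lookup-injective : ∀ {rs} → DistinctClusters rs →
                              ∀ i j → c (lookup rs i) ≡ c (lookup rs j) → i ≡ j
  distinct-lookup-injective (_ ∷ _)   Fin.zero    Fin.zero    _ = refl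
  distinct-lookup-injective (r≢ ∷ _)  Fin.zero    (Fin.suc j) e = ⊥-elim (All.lookup r≢ (∈-lookup j) e)
  distinct-lookup-injective (r≢ ∷ _)  (Fin.suc i) Fin.zero    e =
    ⊥-elim (All.lookup r≢ (∈-lookup i) (sym e))
  distinct-lookup-injective (_ ∷ rs!) (Fin.suc i) (Fin.suc j) e =
    cong Fin.suc (distinct-lookup-injective rs! i j e)

  distinct⇒length≤k : ∀ {rs} → DistinctClusters rs → length rs ≤ k
  distinct⇒length≤k rs! = Fin.injective⇒≤ (distinct-lookup-injective rs! _ _)

  covering⇒k≤length : ∀ {rs} → (∀ j → Any (λ r → c r ≡ j) rs) → k ≤ length rs
  covering⇒k≤length {rs} cover = Fin.injective⇒≤ {f = λ j → index (cover j)} λ {i} {j} same →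
    trans (sym (Any.lookup-index (cover i)))
          (trans (cong (c ∘′ lookup rs) same) (Any.lookup-index (cover j)))

  probes : Fin n → List (Fin n) → ℕ
  probes x [] = 0
  probes x (r ∷ L) with c x ≟ c r
  ... | yes _ = 1
  ... | no _  = suc (probes x L)

  probes≤length : ∀ x L → probes x L ≤ length L
  probes≤length x [] = z≤n
  probes≤length x (r ∷ L) with c x ≟ c r
  ... | yes _ = s≤s z≤n
  ... | no _  = s≤s (probes≤length x L)

  probes-++-unrepresented : ∀ x A B → ¬ Represented x A → probes x (A ++ B) ≡ length A + probes x B
  probes-++-unrepresented x []      B _   = refl
  probes-++-unrepresented x (a ∷ A) B ¬rep with c x ≟ c a
  ... | yes same = ⊥-elim (¬rep (here same))
  ... | no _     = cong suc (probes-++-unrepresented x A B (¬rep ∘ there))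

  probes-++-represented : ∀ x A B → Represented x A → probes x (A ++ B) ≡ probes x A
  probes-++-represented x (a ∷ A) B rep with c x ≟ c a | rep
  ... | yes _    | _          = refl
  ... | no  diff | here same  = ⊥-elim (diff same)
  ... | no  _    | there rep′ = cong suc (probes-++-represented x A B rep′)

  probes-singleton : ∀ x a → c x ≡ c a → probes x [ a ] ≡ 1
  probes-singleton x a same with c x ≟ c a
  ... | yes _    = refl
  ... | no  diff = ⊥-elim (diff same)

  probes-reverse : ∀ x {rs} → DistinctClusters rs → Represented x rs →
                   probes x rs + probes x (reverse rs) ≡ suc (length rs)
  probes-reverse x {a ∷ rs} (a≢ ∷ rs!) rep
    rewrite List.unfold-reverse a rs with c x ≟ c a | rep
  ... | yes same | _ = cong suc (begin
    probes x (reverse rs ++ [ a ])        ≡⟨ probes-++-unrepresented x (reverse rs) [ a ] ¬rep ⟩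
    length (reverse rs) + probes x [ a ]  ≡⟨ cong₂ _+_ (List.length-reverse rs) (probes-singleton x a same) ⟩
    length rs + 1                         ≡⟨ ℕ.+-comm (length rs) 1 ⟩
    suc (length rs)                       ∎)
    where
    open ≡-Reasoning
    ¬rep : ¬ Represented x (reverse rs)
    ¬rep rep′ with find (Any.reverse⁻ rep′)
    ... | r , r∈ , same′ = All.lookup a≢ r∈ (trans (sym same) same′)
  ... | no diff | here same = ⊥-elim (diff same)
  ... | no _    | there rep′ = cong suc (begin
    probes x rs + probes x (reverse rs ++ [ a ]) ≡⟨ cong (probes x rs +_)
                                                      (probes-++-represented x (reverse rs) [ a ] (Any.reverse⁺ rep′)) ⟩
    probes x rs + probes x (reverse rs)          ≡⟨ probes-reverse x rs! rep′ ⟩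
    suc (length rs)                              ∎)
    where open ≡-Reasoning

  insertCost : ∀ {x} rs → Dec (Represented x rs) → ℕ
  insertCost rs (yes _) = suc (length rs)
  insertCost rs (no _)  = length rs + length rs

  addIfNew : ∀ x rs → Dec (Represented x rs) → List (Fin n)
  addIfNew x rs (yes _) = rs
  addIfNew x rs (no _)  = x ∷ rs

  -- Twice the expected number of comparisons, the expectation being over the two scan orders.
  cost : List (Fin n) → List (Fin n) → ℕ
  cost []       rs = 0
  cost (x ∷ xs) rs = insertCost rs (represented? x rs) + cost xs (addIfNew x rs (represented? x rs))

  probes-two-orders≤insertCost : ∀ x {rs} → DistinctClusters rs → (d : Dec (Represented x rs)) →
                       probes x rs + probes x (reverse rs) ≤ insertCost rs d
  probes-two-orders≤insertCost x rs! (yes rep) = ℕ.≤-reflexive (probes-reverse x rs! rep)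
  probes-two-orders≤insertCost x {rs} rs! (no _) =
    ℕ.+-mono-≤ (probes≤length x rs)
               (subst (probes x (reverse rs) ≤_) (List.length-reverse rs) (probes≤length x (reverse rs)))

  Covers : List (Fin n) → List (Fin n) → Set
  Covers xs rs = ∀ y → y ∈ xs ⊎ Represented y rs

  -- With D = length rs, every element of xs adds k + 1 to the right-hand side: finding its
  -- cluster costs D + 1 ≤ k + 1, while opening a new one costs 2D but raises D(k + 2) − D² by
  -- k + 1 − 2D. Once xs is exhausted, D = k.
  cost-bound : IsSurj c → ∀ xs rs → DistinctClusters rs → Covers xs rs →
               cost xs rs + k * 2 + length rs * length rs ≤ length xs * suc k + length rs * (k + 2)
  cost-bound surj [] rs rs! covers = ℕ.≤-reflexive (begin
    k * 2 + D * D ≡⟨ cong (λ m → k * 2 + m * m) D≡k ⟩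
    k * 2 + k * k ≡⟨ solve 1 (λ k → k :* con 2 :+ k :* k := k :* (k :+ con 2)) refl k ⟩
    k * (k + 2)   ≡⟨ cong (_* (k + 2)) D≡k ⟨
    D * (k + 2)   ∎)
    where
    open ≡-Reasoning
    open +-*-Solver
    D = length rs
    cover : ∀ j → Any (λ r → c r ≡ j) rs
    cover j with surj j
    ... | y , cy≡j with covers y
    ...   | inj₂ rep = Any.map (λ cy≡cr → trans (sym cy≡cr) cy≡j) rep
    D≡k : D ≡ k
    D≡k = ℕ.≤-antisym (distinct⇒length≤k rs!) (covering⇒k≤length cover)
  cost-bound surj (x ∷ xs) rs rs! covers with represented? x rs
  ... | yes rep = begin
    suc D + cost xs rs + k * 2 + D * D   ≡⟨ solve 4 (λ D g k2 dd → con 1 :+ D :+ g :+ k2 :+ dd := con 1 :+ D :+ (g :+ k2 :+ dd))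
                                              refl D (cost xs rs) (k * 2) (D * D) ⟩
    suc D + (cost xs rs + k * 2 + D * D) ≤⟨ ℕ.+-mono-≤ (s≤s (distinct⇒length≤k rs!))
                                              (cost-bound surj xs rs rs! covers′) ⟩
    suc k + (m * suc k + D * (k + 2))    ≡⟨ ℕ.+-assoc (suc k) (m * suc k) _ ⟨
    suc m * suc k + D * (k + 2)          ∎
    where
    open ℕ.≤-Reasoning
    open +-*-Solver
    D = length rs
    m = length xs
    covers′ : Covers xs rs
    covers′ y with covers y
    ... | inj₁ (here refl)  = inj₂ rep
    ... | inj₁ (there y∈xs) = inj₁ y∈xs
    ... | inj₂ rep′         = inj₂ rep′
  ... | no ¬rep = ℕ.≤-pred (begin
    suc (D + D + cost xs (x ∷ rs) + k * 2 + D * D) ≡⟨ solve 3 (λ D g k2 →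
                                                          con 1 :+ (D :+ D :+ g :+ k2 :+ D :* D)
                                                          := g :+ k2 :+ (con 1 :+ D) :* (con 1 :+ D))
                                                        refl D (cost xs (x ∷ rs)) (k * 2) ⟩
    cost xs (x ∷ rs) + k * 2 + suc D * suc D      ≤⟨ cost-bound surj xs (x ∷ rs) (All.¬Any⇒All¬ rs ¬rep ∷ rs!)
                                                        covers′ ⟩
    m * suc k + suc D * (k + 2)                   ≡⟨ solve 3 (λ m D k →
                                                          m :* (con 1 :+ k) :+ (con 1 :+ D) :* (k :+ con 2)
                                                          := con 1 :+ ((con 1 :+ m) :* (con 1 :+ k) :+ D :* (k :+ con 2)))
                                                        refl m D k ⟩
    suc (suc m * suc k + D * (k + 2))             ∎)
    where
    open ℕ.≤-Reasoning
    open +-*-Solver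
    D = length rs
    m = length xs
    covers′ : Covers xs (x ∷ rs)
    covers′ y with covers y
    ... | inj₁ (here refl)  = inj₂ (here refl)
    ... | inj₁ (there y∈xs) = inj₁ y∈xs
    ... | inj₂ rep′         = inj₂ (there rep′)

  Labelled : List (Fin n) → List (Fin n) → (Fin n → ℕ) → Set
  Labelled xs rs g = ∀ y → y ∈ xs ⊎ Any (λ r → c y ≡ c r × g y ≡ toℕ r) rs

  labelled⇒covers : ∀ {xs rs g} → Labelled xs rs g → Covers xs rs
  labelled⇒covers lab y = Sum.map₂ (Any.map proj₁) (lab y)

  labelled-assign : ∀ {x xs rs rs′ g r} → Labelled (x ∷ xs) rs g → rs ⊆ rs′ → r ∈ rs′ → c x ≡ c r →
                    Labelled xs rs′ (assign g x r)
  labelled-assign {x} {g = g} lab rs⊆rs′ r∈rs′ same y with y ≟ x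
  ... | yes refl = inj₂ (lose r∈rs′ (same , updateAt-updates x g))
  ... | no y≢x with lab y
  ...   | inj₁ (here y≡x)   = ⊥-elim (y≢x y≡x)
  ...   | inj₁ (there y∈xs) = inj₁ y∈xs
  ...   | inj₂ rep          =
    inj₂ (Any-resp-⊆ rs⊆rs′ (Any.map (Product.map₂ (trans (updateAt-minimal y x g y≢x))) rep))

  labelled⇒samePartition : ∀ {rs g} → DistinctClusters rs → Labelled [] rs g → SamePartition g c
  labelled⇒samePartition rs! lab u v with lab u | lab v
  ... | inj₂ repu | inj₂ repv with find repu | find repv
  ...   | ru , ru∈ , cu≡cru , gu≡ru | rv , rv∈ , cv≡crv , gv≡rv =
    (λ gu≡gv → let ru≡rv = Fin.toℕ-injective (trans (sym gu≡ru) (trans gu≡gv gv≡rv))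
               in trans cu≡cru (trans (cong c ru≡rv) (sym cv≡crv))) ,
    (λ cu≡cv → let ru≡rv = distinct-unique rs! ru∈ rv∈ (trans (sym cu≡cru) (trans cu≡cv cv≡crv))
               in trans gu≡ru (trans (cong toℕ ru≡rv) (sym gv≡rv)))

  two-orders-bound : ∀ e L p q s G → p + q ≤ s →
                     (e * 2 + L * (p * 2 + G)) + (e * 2 + L * (q * 2 + G))
                       ≤ (e * 2 + L * (s + G)) + (e * 2 + L * (s + G))
  two-orders-bound e L p q s G p+q≤s = begin
    (e * 2 + L * (p * 2 + G)) + (e * 2 + L * (q * 2 + G)) ≡⟨ solve (e ∷ L ∷ p ∷ q ∷ G ∷ []) ⟩
    (e * 2 + e * 2) + L * ((p + q) * 2 + (G + G))       ≤⟨ ℕ.+-monoʳ-≤ (e * 2 + e * 2)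
                                                             (ℕ.*-monoʳ-≤ L (ℕ.+-monoˡ-≤ (G + G) (ℕ.*-monoˡ-≤ 2 p+q≤s))) ⟩
    (e * 2 + e * 2) + L * (s * 2 + (G + G))             ≡⟨ solve (e ∷ L ∷ s ∷ G ∷ []) ⟩
    (e * 2 + L * (s + G)) + (e * 2 + L * (s + G))       ∎
    where
    open ℕ.≤-Reasoning
    open RS using (solve)

  needed : Bool → ℕ → ℕ → ℕ
  needed true  same diff = same
  needed false same diff = diff

  vote-overhead : ∀ e Φ → suc ℓ * 2 + (e * 2 + suc ℓ * Φ) ≡ e * 2 + suc ℓ * (2 + Φ)
  vote-overhead e Φ = RS.solve (ℓ ∷ e ∷ Φ ∷ [])

  module _ (adv : Oracle n) where

    -- Bounds are counted in half-queries.
    record CorrectWithin (t : Alg n) (h : History n) (X : ℕ) : Set where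
      constructor _,_
      field
        correct : AlwaysCorrect c adv t h
        within  : expQueries adv t h ℚ.≤ half X

    Costs : Alg n → History n → ℕ → ℕ → Set
    Costs t h e X = Admissible c adv t h e → CorrectWithin t h X

    -- Φ counts doubled comparisons of ℓ + 1 queries each; the remaining error budget e adds e queries.
    CostsAtMost : Alg n → ℕ → Set
    CostsAtMost t Φ = ∀ h e → e ≤ ℓ → Costs t h e (e * 2 + suc ℓ * Φ)

    Costs-mono : ∀ {t h e X Y} → X ≤ Y → Costs t h e X → Costs t h e Y
    Costs-mono X≤Y costs adm with costs adm
    ... | correct , E≤X = correct , ℚ.≤-trans E≤X (half-mono-≤ X≤Y)

    query-charge : ∀ {u v u≢v K h X} → CorrectWithin (K (adv h u v)) ((u , v , adv h u v) ∷ h) X →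
                   CorrectWithin (query u v u≢v K) h (2 + X)
    query-charge {X = X} (correct , E≤X) =
      correct , subst (_ ℚ.≤_) (sym (half-homo-+ 2 X)) (ℚ.+-monoʳ-≤ ℚ.1ℚ E≤X)

    query-costs : ∀ {u v u≢v K h e X} →
                  (∀ {w} → w ≡ truth c u v → Costs (K w) ((u , v , w) ∷ h) e X) →
                  (∀ {w e′} → e ≡ suc e′ → w ≢ truth c u v →
                     Costs (K w) ((u , v , w) ∷ h) e′ X) →
                  Costs (query u v u≢v K) h e (2 + X)
    query-costs right wrong (adm-ok  w≡tr adm) = query-charge (right w≡tr adm)
    query-costs right wrong (adm-err w≢tr adm) = query-charge (wrong refl w≢tr adm)

    module _ {u v : Fin n} (u≢v : u ≢ v) (K : Bool → Alg n) {Ψ : ℕ} where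

      vote-costs : ∀ t → truth c u v ≡ t → (∀ h e → e ≤ ℓ → Costs (K t) h e (e * 2 + Ψ)) →
                   ∀ same diff h e → e ≤ ℓ → e < needed (not t) same diff →
                   Costs (vote u≢v K same diff) h e (needed t same diff * 2 + (e * 2 + Ψ))
      vote-costs true  tr continue zero    diff    h e e≤ℓ _  = continue h e e≤ℓ
      vote-costs false tr continue (suc s) zero    h e e≤ℓ _  = continue h e e≤ℓ
      vote-costs true  tr continue (suc s) (suc d) h e e≤ℓ e<d = query-costs right wrong
        where
        right : ∀ {w} → w ≡ truth c u v →
                Costs (vote-after u≢v K s d w) ((u , v , w) ∷ h) e (s * 2 + (e * 2 + Ψ))
        right {true}  _    = vote-costs true tr continue s (suc d) _ e e≤ℓ e<d
        right {false} w≡tr with () ← trans w≡tr tr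
        wrong : ∀ {w e′} → e ≡ suc e′ → w ≢ truth c u v →
                Costs (vote-after u≢v K s d w) ((u , v , w) ∷ h) e′ (s * 2 + (e * 2 + Ψ))
        wrong {true}  _ w≢tr = ⊥-elim (w≢tr (sym tr))
        wrong {false} {e′} refl _ = Costs-mono (ℕ.≤-reflexive (x∙yz≈y∙xz 2 (s * 2) (e′ * 2 + Ψ)))
          (vote-costs true tr continue (suc s) d _ e′ (ℕ.≤-trans (ℕ.n≤1+n e′) e≤ℓ) (ℕ.s<s⁻¹ e<d))
      vote-costs false tr continue (suc s) (suc d) h e e≤ℓ e<s = query-costs right wrong
        where
        right : ∀ {w} → w ≡ truth c u v →
                Costs (vote-after u≢v K s d w) ((u , v , w) ∷ h) e (d * 2 + (e * 2 + Ψ))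
        right {false} _    = vote-costs false tr continue (suc s) d _ e e≤ℓ e<s
        right {true}  w≡tr with () ← trans w≡tr tr
        wrong : ∀ {w e′} → e ≡ suc e′ → w ≢ truth c u v →
                Costs (vote-after u≢v K s d w) ((u , v , w) ∷ h) e′ (d * 2 + (e * 2 + Ψ))
        wrong {false} _ w≢tr = ⊥-elim (w≢tr (sym tr))
        wrong {true} {e′} refl _ = Costs-mono (ℕ.≤-reflexive (x∙yz≈y∙xz 2 (d * 2) (e′ * 2 + Ψ)))
          (vote-costs false tr continue s (suc d) _ e′ (ℕ.≤-trans (ℕ.n≤1+n e′) e≤ℓ) (ℕ.s<s⁻¹ e<s))

    ifSameCluster-same : ∀ {x r A B Φ} → c x ≡ c r → CostsAtMost A Φ →
                         CostsAtMost (ifSameCluster x r A B) (2 + Φ)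
    ifSameCluster-same {x} {r} {A} {B} {Φ} same costsA h e e≤ℓ with x ≟ r
    ... | yes _   = Costs-mono (ℕ.+-monoʳ-≤ (e * 2) (ℕ.*-monoʳ-≤ (suc ℓ) (ℕ.m≤n+m Φ 2))) (costsA h e e≤ℓ)
    ... | no x≢r = Costs-mono (ℕ.≤-reflexive (vote-overhead e Φ))
      (vote-costs x≢r _ true (dec-true (c x ≟ c r) same) costsA (suc ℓ) (suc ℓ) h e e≤ℓ (s≤s e≤ℓ))

    ifSameCluster-diff : ∀ {x r A B Φ} → c x ≢ c r → CostsAtMost B Φ →
                         CostsAtMost (ifSameCluster x r A B) (2 + Φ)
    ifSameCluster-diff {x} {r} {A} {B} {Φ} diff costsB h e e≤ℓ with x ≟ r
    ... | yes refl = ⊥-elim (diff refl)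
    ... | no x≢r  = Costs-mono (ℕ.≤-reflexive (vote-overhead e Φ))
      (vote-costs x≢r _ false (dec-false (c x ≟ c r) diff) costsB (suc ℓ) (suc ℓ) h e e≤ℓ (s≤s e≤ℓ))

    mutual
      process-costs : ∀ xs rs g → DistinctClusters rs → Labelled xs rs g →
                      CostsAtMost (process xs rs g) (cost xs rs)
      process-costs []       rs g rs! lab h e e≤ℓ adm-out =
        labelled⇒samePartition rs! lab , half-nonNeg (e * 2 + suc ℓ * 0)
      process-costs (x ∷ xs) rs g rs! lab h e e≤ℓ (adm-coin adm) =
        bothCorrect ,
        half-average (λ i → expQueries adv (scan x xs rs g (order i rs)) h) X₀ X₁ X (within inOrder) (within reversed)
          (two-orders-bound e (suc ℓ) (probes x rs) (probes x (reverse rs)) (insertCost rs d) G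
             (probes-two-orders≤insertCost x rs! d))
        where
        open CorrectWithin
        d = represented? x rs
        G = cost xs (addIfNew x rs d)
        X₀ = e * 2 + suc ℓ * (probes x rs * 2 + G)
        X₁ = e * 2 + suc ℓ * (probes x (reverse rs) * 2 + G)
        X  = e * 2 + suc ℓ * (insertCost rs d + G)
        inOrder : CorrectWithin (scan x xs rs g rs) h X₀
        inOrder = scan-costs x xs rs g rs d rs! lab id (λ r∈rs _ → r∈rs) h e e≤ℓ (adm heads)
        reversed : CorrectWithin (scan x xs rs g (reverse rs)) h X₁
        reversed = scan-costs x xs rs g (reverse rs) d rs! lab Any.reverse⁻ (λ r∈rs _ → Any.reverse⁺ r∈rs)
                     h e e≤ℓ (adm tails)
        bothCorrect : ∀ i → AlwaysCorrect c adv (scan x xs rs g (order i rs)) h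
        bothCorrect heads = correct inOrder
        bothCorrect tails = correct reversed

      scan-costs : ∀ x xs rs g L (d : Dec (Represented x rs)) → DistinctClusters rs → Labelled (x ∷ xs) rs g →
                   L ⊆ rs → (∀ {r} → r ∈ rs → c x ≡ c r → r ∈ L) →
                   CostsAtMost (scan x xs rs g L) (probes x L * 2 + cost xs (addIfNew x rs d))
      scan-costs x xs rs g [] (yes rep) rs! lab L⊆rs complete with find rep
      ... | r , r∈rs , same with () ← complete r∈rs same
      scan-costs x xs rs g [] (no ¬rep) rs! lab L⊆rs complete =
        process-costs xs (x ∷ rs) (assign g x x) (All.¬Any⇒All¬ rs ¬rep ∷ rs!)
          (labelled-assign lab there (here refl) refl)
      scan-costs x xs rs g (r ∷ L) d rs! lab L⊆rs complete with c x ≟ c r | d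
      ... | yes same | yes _   =
        ifSameCluster-same same
          (process-costs xs rs (assign g x r) rs! (labelled-assign lab id (L⊆rs (here refl)) same))
      ... | yes same | no ¬rep = ⊥-elim (¬rep (lose (L⊆rs (here refl)) same))
      ... | no diff  | d′      =
        ifSameCluster-diff diff (scan-costs x xs rs g L d′ rs! lab (L⊆rs ∘ there) complete′)
        where
        complete′ : ∀ {r′} → r′ ∈ rs → c x ≡ c r′ → r′ ∈ L
        complete′ r′∈rs same with complete r′∈rs same
        ... | here refl    = ⊥-elim (diff same)
        ... | there r′∈L = r′∈L

  learner-labelled : Labelled (allFin n) [] (const 0)
  learner-labelled y = inj₁ (∈-allFin y)

  learner-cost : IsSurj c → cost (allFin n) [] + k * 2 ≤ n * suc k
  learner-cost surj =
    subst₂ _≤_ (ℕ.+-identityʳ _) (trans (ℕ.+-identityʳ _) (cong (_* suc k) (List.length-tabulate {n = n} id)))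
      (cost-bound surj (allFin n) [] [] (labelled⇒covers learner-labelled))

  learner-solves : IsSurj c → (adv : Oracle n) → Admissible c adv learner [] ℓ →
                   AlwaysCorrect c adv learner [] × expQueries adv learner [] ℚ.≤ bound n k ℓ
  learner-solves surj adv adm =
    correct run ,
    ℚ.≤-trans (within run)
      (subst (half X ℚ.≤_) (sym (bound-as-half n k ℓ)) (half-≤-minus {X} {suc ℓ * (n * suc k) + ℓ * 2} {suc ℓ * k} total))
    where
    open CorrectWithin
    C = cost (allFin n) []
    X = ℓ * 2 + suc ℓ * C
    run : CorrectWithin adv learner [] X
    run = process-costs adv (allFin n) [] (const 0) [] learner-labelled [] ℓ ℕ.≤-refl adm
    total : X + suc ℓ * k * 2 ≤ suc ℓ * (n * suc k) + ℓ * 2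
    total = begin
      X + suc ℓ * k * 2            ≡⟨ solve 4 (λ l L C k →
                                          (l :* con 2 :+ L :* C) :+ L :* k :* con 2 := L :* (C :+ k :* con 2) :+ l :* con 2)
                                        refl ℓ (suc ℓ) C k ⟩
      suc ℓ * (C + k * 2) + ℓ * 2  ≤⟨ ℕ.+-monoˡ-≤ (ℓ * 2) (ℕ.*-monoʳ-≤ (suc ℓ) (learner-cost surj)) ⟩
      suc ℓ * (n * suc k) + ℓ * 2  ∎
      where
      open ℕ.≤-Reasoning
      open +-*-Solver

theorem3 : (n ℓ : ℕ) →
    ((k : ℕ) → 1 ≤ k → k ≤ n → Σ (Alg n) (λ A → Solves n k ℓ A))
    × Σ (Alg n) (λ A → (k : ℕ) → 1 ≤ k → k ≤ n → Solves n k ℓ A)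
theorem3 n ℓ = (λ k _ _ → learner , solves k) , (learner , λ k _ _ → solves k)
  where
  open Learner n ℓ using (learner)
  solves : ∀ k → Solves n k ℓ learner
  solves k c surj = Analysis.learner-solves n ℓ k c surj
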